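{- Let $\mathcal{G}$ be an undirected connected graph without loops on $C=\{1,\dots,L\}$, let $k\ge1$, and let $N^k$ be as in the context. A subspace $A\subseteq\mathbb{B}^L$ is a trap space for $N^k$ if and only if $A=x[I]$ for some fixed point $x$ of $N^k$ and some $I\subseteq C$ such that for every $i\in S(I)\setminus I$: (i) if $x_i=1$, then the set $\{j\in S(i)\setminus I : x_j=0\}$ has cardinality at least $k$; (ii) if $x_i=0$, then the set $\{j\in S(i)\setminus I: x_j=0\}\cup(S(i)\cap I)$ has cardinality smaller than $k$.
   Context: For $i\in C$ let $S(i)$ be the set of neighbours of $i$ in $\mathcal{G}$, and for $A\subseteq C$ let $S(A)=\bigcup_{i\in A}S(i)$. $\mathbb{B}=\{0,1\}$. $N^k\colon\mathbb{B}^L\to\mathbb{B}^L$ is defined by $N^k_i(n)=1$ iff $\sum_{j\in S(i)}(1-n_j)\ge k$. $AD_{N^k}$ is the directed graph on $\mathbb{B}^L$ with an edge from $y$ to the state obtained by flipping coordinate $i$ whenever $N^k_i(y)\neq y_i$. For $x\in\mathbb{B}^L$, $I\subseteq C$, the subspace $x[I]$ is $\{y: y_i=x_i\ \forall i\notin I\}$; a trap space is a subspace such that every successor in $AD_{N^k}$ of its states lies in it. A fixed point is $x$ with $N^k(x)=x$. -}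

module Defs where

open import Data.Bool using (Bool; true; false; not)
open import Data.Nat using (ℕ; _≤ᵇ_)
open import Data.Fin using (Fin)
open import Data.Fin.Subset using (Subset; _∈_; _∉_; _∩_; _∪_; ∁; ∣_∣)
open import Data.Vec using (Vec; lookup; tabulate; map; _[_]≔_)
open import Data.Product using (∃; _×_)
open import Relation.Binary.PropositionalEquality using (_≡_; _≢_)
open import Relation.Binary.Construct.Closure.ReflexiveTransitive using (Star)

record Graph (L : ℕ) : Set where
  field
    adj    : Fin L → Fin L → Bool
    symm   : ∀ i j → adj i j ≡ adj j i
    noLoop : ∀ i → adj i i ≡ false
open Graph public

Connected : ∀ {L} → Graph L → Set
Connected {L} G = ∀ (i j : Fin L) → Star (λ a b → adj G a b ≡ true) i j

State : ℕ → Set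
State L = Vec Bool L

module _ {L : ℕ} (G : Graph L) where

  S : Fin L → Subset L
  S i = tabulate (λ j → adj G i j)

  _∈S[_] : Fin L → Subset L → Set
  j ∈S[ I ] = ∃ λ i → i ∈ I × j ∈ S i

  zeros : State L → Subset L
  zeros n = map not n

  N : ℕ → State L → State L
  N k n = tabulate (λ i → k ≤ᵇ ∣ S i ∩ zeros n ∣)

  flip : State L → Fin L → State L
  flip y i = y [ i ]≔ not (lookup y i)

  ADEdge : ℕ → State L → State L → Set
  ADEdge k y z = ∃ λ i → lookup (N k y) i ≢ lookup y i × z ≡ flip y i

  _[_]ˢ : State L → Subset L → State L → Set
  (x [ I ]ˢ) y = ∀ i → i ∉ I → lookup y i ≡ lookup x i

  IsTrapSpace : ℕ → (State L → Set) → Set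
  IsTrapSpace k A = ∀ y z → A y → ADEdge k y z → A z

  FixedPoint : ℕ → State L → Set
  FixedPoint k x = N k x ≡ x

  SameSet : (State L → Set) → (State L → Set) → Set
  SameSet A B = ∀ y → (A y → B y) × (B y → A y)

-- Threshold dynamics on a symmetric loop-free graph has a Lyapunov function: if Z is the zero set
-- of a state, E = #{(i , j) ∈ Z² adjacent} + (2k − 1)·#{ones} strictly decreases along every edge
-- of AD_{N^k}, so every trap space contains a fixed point x.  If x[I] is a trap space, the states
-- obtained from x by setting all of I to 1, resp. to 0, lie in x[I] and are stable outside I;
-- read off at i ∉ I this is (i), resp. (ii).  Conversely, a state w ∈ x[I] has between
-- |S(i) ∖ I ∩ zeros x| and |(S(i) ∖ I ∩ zeros x) ∪ (S(i) ∩ I)| zero neighbours, so (i), (ii) and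
-- N^k(x) = x keep every coordinate outside I stable, and x[I] is closed under AD_{N^k}.

module Submission where

open import Defs
open import Algebra.Lattice.Properties.BooleanAlgebra using (¬-involutive)
open import Data.Bool using (Bool; true; false; not; _∧_; _∨_; T)
open import Data.Bool.Properties
  using (T-≡; ∧-identityʳ; ∧-zeroʳ; ∨-identityʳ; not-involutive; not-¬; ¬-not) renaming (_≟_ to _≟ᵇ_)
open import Data.Empty using (⊥-elim)
open import Data.Fin using (Fin; zero; suc)
open import Data.Fin.Properties using (all?; any?; ¬∀⟶∃¬; suc-injective) renaming (_≟_ to _≟ᶠ_)
open import Data.Fin.Subset using (Subset; _∈_; _∉_; _⊆_; _∩_; _∪_; ∁; ∣_∣)
open import Data.Fin.Subset.Properties
  using (_∈?_; x∈p∩q⁺; x∈p∩q⁻; x∈p∪q⁺; x∈∁p⇒x∉p; x∉p⇒x∈∁p; p⊆q⇒∣p∣≤∣q∣;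
         ∩-distribˡ-∪; ∪-∩-booleanAlgebra)
open import Data.Nat using (ℕ; suc; _+_; _*_; _≤_; _<_; _≤ᵇ_; s≤s)
open import Data.Nat.Induction using (<-wellFounded)
open import Data.Nat.Properties
  using (+-0-commutativeMonoid; +-commutativeSemigroup; +-assoc; +-suc; +-identityʳ; *-identityˡ; *-comm;
         *-distribˡ-+; +-monoʳ-<; +-cancelʳ-<; ≤-trans; ≤-<-trans; ≰⇒>; <⇒≱; ≤-pred; ≤-reflexive;
         *-monoʳ-≤; *-suc; ≤ᵇ⇒≤; ≤⇒≤ᵇ)
open import Data.Nat.Tactic.RingSolver using (solve-∀)
open import Algebra.Properties.CommutativeMonoid.Sum +-0-commutativeMonoid
  using (sum; sum-syntax; ∑-distrib-+; sum-cong-≗)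
open import Algebra.Properties.CommutativeSemigroup +-commutativeSemigroup using (xy∙z≈xz∙y)
open import Data.Product using (∃; ∃₂; _×_; _,_; proj₁; proj₂; swap)
open import Data.Sum using (_⊎_; inj₁; inj₂)
open import Data.Vec using ([]; _∷_; lookup; _[_]≔_; here; there)
open import Data.Vec.Properties
  using (lookup∘tabulate; lookup-map; lookup-zipWith; lookup∘update; lookup∘update′; []≔-lookup;
         map-[]≔; []=⇒lookup; lookup⇒[]=)
open import Data.Vec.Relation.Binary.Pointwise.Extensional using (ext; Pointwise-≡⇒≡)
open import Function using (_∘_)
open import Function.Bundles using (_⇔_; mk⇔; Equivalence)
open import Induction.WellFounded using (Acc; acc)
open import Relation.Nullary using (yes; no; _×-dec_)
open import Relation.Binary.PropositionalEquality

𝟙 : Bool → ℕ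
𝟙 true  = 1
𝟙 false = 0

𝟙-∧ : ∀ a b → 𝟙 (a ∧ b) ≡ 𝟙 a * 𝟙 b
𝟙-∧ true  b = sym (+-identityʳ (𝟙 b))
𝟙-∧ false b = refl

sum-update : ∀ {n} (v : Fin n) (x : ℕ) {f g : Fin n → ℕ} →
             (∀ i → i ≢ v → g i ≡ f i) → g v ≡ f v + x → sum g ≡ sum f + x
sum-update zero x {f} {g} g≡f gv≡fv+x = begin
  g zero + sum (g ∘ suc)       ≡⟨ cong₂ _+_ gv≡fv+x (sum-cong-≗ (λ i → g≡f (suc i) λ ())) ⟩
  f zero + x + sum (f ∘ suc)   ≡⟨ xy∙z≈xz∙y (f zero) x _ ⟩
  f zero + sum (f ∘ suc) + x   ∎
  where open ≡-Reasoning
sum-update (suc v) x {f} {g} g≡f gv≡fv+x = begin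
  g zero + sum (g ∘ suc)
    ≡⟨ cong₂ _+_ (g≡f zero λ ()) (sum-update v x (λ i i≢v → g≡f (suc i) (i≢v ∘ suc-injective)) gv≡fv+x) ⟩
  f zero + (sum (f ∘ suc) + x) ≡⟨ +-assoc (f zero) _ x ⟨
  f zero + sum (f ∘ suc) + x   ∎
  where open ≡-Reasoning

≤ᵇ≡true⇒≤ : ∀ {m n} → (m ≤ᵇ n) ≡ true → m ≤ n
≤ᵇ≡true⇒≤ {m} {n} eq = ≤ᵇ⇒≤ m n (Equivalence.from T-≡ eq)

≤ᵇ≡false⇒> : ∀ {m n} → (m ≤ᵇ n) ≡ false → n < m
≤ᵇ≡false⇒> eq = ≰⇒> (λ m≤n → subst T eq (≤⇒≤ᵇ m≤n))

≤ᵇ-between : ∀ {k lo n hi} b → lo ≤ n → n ≤ hi →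
             (b ≡ true → k ≤ lo) → (b ≡ false → hi < k) → (k ≤ᵇ n) ≡ b
≤ᵇ-between true  lo≤n _ k≤lo _ = Equivalence.to T-≡ (≤⇒≤ᵇ (≤-trans (k≤lo refl) lo≤n))
≤ᵇ-between {k} {n = n} false _ n≤hi _ hi<k with k ≤ᵇ n in k≤ᵇn
... | false = refl
... | true  = ⊥-elim (<⇒≱ (≤-<-trans n≤hi (hi<k refl)) (≤ᵇ≡true⇒≤ k≤ᵇn))

+-≡-cancel-< : ∀ {a b c e} → a + c ≡ b + e → e < c → a < b
+-≡-cancel-< {a} {b} {c} {e} a+c≡b+e e<c =
  +-cancelʳ-< c a b (subst (_< b + c) (sym a+c≡b+e) (+-monoʳ-< b e<c))

∉⇒lookup≡false : ∀ {n} (p : Subset n) {j} → j ∉ p → lookup p j ≡ false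
∉⇒lookup≡false p {j} j∉p with lookup p j in eq
... | false = refl
... | true  = ⊥-elim (j∉p (lookup⇒[]= j p eq))

∈∁⇒lookup≡false : ∀ {n} (p : Subset n) {j} → j ∈ ∁ p → lookup p j ≡ false
∈∁⇒lookup≡false p j∈∁p = ∉⇒lookup≡false p (x∈∁p⇒x∉p j∈∁p)

lookup≡false⇒∈∁ : ∀ {n} (p : Subset n) {j} → lookup p j ≡ false → j ∈ ∁ p
lookup≡false⇒∈∁ p {j} p[j]≡false = lookup⇒[]= j (∁ p) (trans (lookup-map j not p) (cong not p[j]≡false))

∩∁-cong : ∀ {n} (p : Subset n) {u w} → (∀ {j} → j ∈ p → lookup u j ≡ lookup w j) → p ∩ ∁ u ≡ p ∩ ∁ w
∩∁-cong []          {[]}    {[]}    agree = refl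
∩∁-cong (true ∷ p)  {_ ∷ u} {_ ∷ w} agree = cong₂ _∷_ (cong not (agree here)) (∩∁-cong p (agree ∘ there))
∩∁-cong (false ∷ p) {_ ∷ u} {_ ∷ w} agree = cong (false ∷_) (∩∁-cong p (agree ∘ there))

∣p∣≡∑𝟙 : ∀ {n} (p : Subset n) → ∣ p ∣ ≡ ∑[ i < n ] 𝟙 (lookup p i)
∣p∣≡∑𝟙 []          = refl
∣p∣≡∑𝟙 (true ∷ p)  = cong suc (∣p∣≡∑𝟙 p)
∣p∣≡∑𝟙 (false ∷ p) = ∣p∣≡∑𝟙 p

∣p∩q∣≡∑𝟙*𝟙 : ∀ {n} (p q : Subset n) → ∣ p ∩ q ∣ ≡ ∑[ i < n ] (𝟙 (lookup p i) * 𝟙 (lookup q i))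
∣p∩q∣≡∑𝟙*𝟙 p q = trans (∣p∣≡∑𝟙 (p ∩ q))
  (sum-cong-≗ λ i → trans (cong 𝟙 (lookup-zipWith _∧_ i p q)) (𝟙-∧ (lookup p i) (lookup q i)))

∣p[i]≔b∣ : ∀ {n} (p : Subset n) i b → ∣ p [ i ]≔ b ∣ ≡ 𝟙 b + ∣ p [ i ]≔ false ∣
∣p[i]≔b∣ (_ ∷ p)     zero    true  = refl
∣p[i]≔b∣ (_ ∷ p)     zero    false = refl
∣p[i]≔b∣ (true ∷ p)  (suc i) b     = trans (cong suc (∣p[i]≔b∣ p i b)) (sym (+-suc (𝟙 b) _))
∣p[i]≔b∣ (false ∷ p) (suc i) b     = ∣p[i]≔b∣ p i b

∩-[]≔ : ∀ {n} (p q : Subset n) i b → p ∩ (q [ i ]≔ b) ≡ (p ∩ q) [ i ]≔ (lookup p i ∧ b)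
∩-[]≔ (x ∷ p) (y ∷ q) zero    b = refl
∩-[]≔ (x ∷ p) (y ∷ q) (suc i) b = cong (x ∧ y ∷_) (∩-[]≔ p q i b)

∩-monoʳ-⊆ : ∀ {n} (p : Subset n) {q r} → q ⊆ r → p ∩ q ⊆ p ∩ r
∩-monoʳ-⊆ p {q} q⊆r j∈p∩q with x∈p∩q⁻ p q j∈p∩q
... | j∈p , j∈q = x∈p∩q⁺ (j∈p , q⊆r j∈q)

∁-involutive : ∀ {n} (p : Subset n) → ∁ (∁ p) ≡ p
∁-involutive {n} = ¬-involutive (∪-∩-booleanAlgebra n)

module _ {L : ℕ} (G : Graph L) where

  lookup-S : ∀ i j → lookup (S G i) j ≡ adj G i j
  lookup-S i = lookup∘tabulate (adj G i)

  S-sym : ∀ {i j} → j ∈ S G i → i ∈ S G j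
  S-sym {i} {j} j∈Si = lookup⇒[]= i (S G j)
    (trans (lookup-S j i) (trans (symm G j i) (trans (sym (lookup-S i j)) ([]=⇒lookup j∈Si))))

  S[v]∩Z[v]≔b≡S[v]∩Z : ∀ Z v b → S G v ∩ (Z [ v ]≔ b) ≡ S G v ∩ Z
  S[v]∩Z[v]≔b≡S[v]∩Z Z v b = begin
    S G v ∩ (Z [ v ]≔ b)                       ≡⟨ ∩-[]≔ (S G v) Z v b ⟩
    (S G v ∩ Z) [ v ]≔ (lookup (S G v) v ∧ b)  ≡⟨ cong (λ a → (S G v ∩ Z) [ v ]≔ (a ∧ b)) v∉Sv ⟩
    (S G v ∩ Z) [ v ]≔ false                   ≡⟨ cong ((S G v ∩ Z) [ v ]≔_) v∉Sv∩Z ⟨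
    (S G v ∩ Z) [ v ]≔ lookup (S G v ∩ Z) v    ≡⟨ []≔-lookup (S G v ∩ Z) v ⟩
    S G v ∩ Z                                  ∎
    where
      open ≡-Reasoning
      v∉Sv : lookup (S G v) v ≡ false
      v∉Sv = trans (lookup-S v v) (noLoop G v)
      v∉Sv∩Z : lookup (S G v ∩ Z) v ≡ false
      v∉Sv∩Z = trans (lookup-zipWith _∧_ v (S G v) Z) (cong (_∧ lookup Z v) v∉Sv)

  ∣S∩Z[v]≔true∣ : ∀ Z v i → ∣ S G i ∩ (Z [ v ]≔ true) ∣ ≡ 𝟙 (adj G i v) + ∣ S G i ∩ (Z [ v ]≔ false) ∣
  ∣S∩Z[v]≔true∣ Z v i = begin
    ∣ S G i ∩ (Z [ v ]≔ true) ∣                                 ≡⟨ cong ∣_∣ (∩-[]≔ (S G i) Z v true) ⟩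
    ∣ (S G i ∩ Z) [ v ]≔ (lookup (S G i) v ∧ true) ∣            ≡⟨ ∣p[i]≔b∣ (S G i ∩ Z) v _ ⟩
    𝟙 (lookup (S G i) v ∧ true) + ∣ (S G i ∩ Z) [ v ]≔ false ∣  ≡⟨ cong₂ _+_ (cong 𝟙 S[i,v]) (cong ∣_∣ Z[v]≔false) ⟩
    𝟙 (adj G i v) + ∣ S G i ∩ (Z [ v ]≔ false) ∣                ∎
    where
      open ≡-Reasoning
      S[i,v] : lookup (S G i) v ∧ true ≡ adj G i v
      S[i,v] = trans (∧-identityʳ _) (lookup-S i v)
      Z[v]≔false : (S G i ∩ Z) [ v ]≔ false ≡ S G i ∩ (Z [ v ]≔ false)
      Z[v]≔false = trans (cong ((S G i ∩ Z) [ v ]≔_) (sym (∧-zeroʳ _))) (sym (∩-[]≔ (S G i) Z v false))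

  internalDegreeSum : Subset L → ℕ
  internalDegreeSum Z = ∑[ i < L ] (𝟙 (lookup Z i) * ∣ S G i ∩ Z ∣)

  internalDegreeSum-[]≔ : ∀ Z v →
    internalDegreeSum (Z [ v ]≔ true) ≡ internalDegreeSum (Z [ v ]≔ false) + 2 * ∣ S G v ∩ Z ∣
  internalDegreeSum-[]≔ Z v = begin
    ∑[ i < L ] (𝟙 (Z⁺ i) * ∣ S G i ∩ (Z [ v ]≔ true) ∣)
      ≡⟨ sum-cong-≗ (λ i → trans (cong (𝟙 (Z⁺ i) *_) (∣S∩Z[v]≔true∣ Z v i)) (*-distribˡ-+ (𝟙 (Z⁺ i)) _ _)) ⟩
    ∑[ i < L ] (𝟙 (Z⁺ i) * 𝟙 (adj G i v) + 𝟙 (Z⁺ i) * d⁻ i)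
      ≡⟨ ∑-distrib-+ (λ i → 𝟙 (Z⁺ i) * 𝟙 (adj G i v)) (λ i → 𝟙 (Z⁺ i) * d⁻ i) ⟩
    ∑[ i < L ] (𝟙 (Z⁺ i) * 𝟙 (adj G i v)) + ∑[ i < L ] (𝟙 (Z⁺ i) * d⁻ i)
      ≡⟨ cong₂ _+_ neighbours-in-Z⁺ (sum-update v d off-v at-v) ⟩
    d + (internalDegreeSum (Z [ v ]≔ false) + d)
      ≡⟨ rearrange (internalDegreeSum (Z [ v ]≔ false)) d ⟩
    internalDegreeSum (Z [ v ]≔ false) + 2 * d
      ∎
    where
      open ≡-Reasoning
      Z⁺ Z⁻ : Fin L → Bool
      Z⁺ = lookup (Z [ v ]≔ true)
      Z⁻ = lookup (Z [ v ]≔ false)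
      d⁻ : Fin L → ℕ
      d⁻ i = ∣ S G i ∩ (Z [ v ]≔ false) ∣
      d : ℕ
      d = ∣ S G v ∩ Z ∣
      rearrange : ∀ q d → d + (q + d) ≡ q + 2 * d
      rearrange = solve-∀
      neighbours-in-Z⁺ : ∑[ i < L ] (𝟙 (Z⁺ i) * 𝟙 (adj G i v)) ≡ d
      neighbours-in-Z⁺ = begin
        ∑[ i < L ] (𝟙 (Z⁺ i) * 𝟙 (adj G i v))
          ≡⟨ sum-cong-≗ (λ i → trans (*-comm (𝟙 (Z⁺ i)) _)
                               (cong (λ a → 𝟙 a * 𝟙 (Z⁺ i)) (trans (symm G i v) (sym (lookup-S v i))))) ⟩
        ∑[ i < L ] (𝟙 (lookup (S G v) i) * 𝟙 (Z⁺ i))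
          ≡⟨ ∣p∩q∣≡∑𝟙*𝟙 (S G v) (Z [ v ]≔ true) ⟨
        ∣ S G v ∩ (Z [ v ]≔ true) ∣
          ≡⟨ cong ∣_∣ (S[v]∩Z[v]≔b≡S[v]∩Z Z v true) ⟩
        d ∎
      off-v : ∀ i → i ≢ v → 𝟙 (Z⁺ i) * d⁻ i ≡ 𝟙 (Z⁻ i) * d⁻ i
      off-v i i≢v =
        cong (λ b → 𝟙 b * d⁻ i) (trans (lookup∘update′ i≢v Z true) (sym (lookup∘update′ i≢v Z false)))
      at-v : 𝟙 (Z⁺ v) * d⁻ v ≡ 𝟙 (Z⁻ v) * d⁻ v + d
      at-v = begin
        𝟙 (Z⁺ v) * d⁻ v       ≡⟨ cong (λ b → 𝟙 b * d⁻ v) (lookup∘update v Z true) ⟩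
        1 * d⁻ v              ≡⟨ *-identityˡ (d⁻ v) ⟩
        d⁻ v                  ≡⟨ cong ∣_∣ (S[v]∩Z[v]≔b≡S[v]∩Z Z v false) ⟩
        d                     ≡⟨ cong (λ b → 𝟙 b * d⁻ v + d) (lookup∘update v Z false) ⟨
        𝟙 (Z⁻ v) * d⁻ v + d   ∎

  energy : ℕ → State L → ℕ
  energy c z = internalDegreeSum (zeros G z) + c * ∣ z ∣

  energy-[]≔ : ∀ c z v →
    energy c (z [ v ]≔ false) + c ≡ energy c (z [ v ]≔ true) + 2 * ∣ S G v ∩ zeros G z ∣
  energy-[]≔ c z v = begin
    internalDegreeSum (zeros G (z [ v ]≔ false)) + c * o + c
      ≡⟨ cong (λ Z → internalDegreeSum Z + c * o + c) (map-[]≔ not z v) ⟩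
    internalDegreeSum (zeros G z [ v ]≔ true) + c * o + c
      ≡⟨ cong (λ q → q + c * o + c) (internalDegreeSum-[]≔ (zeros G z) v) ⟩
    Q⁻ + 2 * d + c * o + c
      ≡⟨ rearrange Q⁻ d c o ⟩
    Q⁻ + c * (1 + o) + 2 * d
      ≡⟨ cong₂ (λ Z n → internalDegreeSum Z + c * n + 2 * d) (map-[]≔ not z v) (∣p[i]≔b∣ z v true) ⟨
    internalDegreeSum (zeros G (z [ v ]≔ true)) + c * ∣ z [ v ]≔ true ∣ + 2 * d
      ∎
    where
      open ≡-Reasoning
      o d Q⁻ : ℕ
      o  = ∣ z [ v ]≔ false ∣
      d  = ∣ S G v ∩ zeros G z ∣
      Q⁻ = internalDegreeSum (zeros G z [ v ]≔ false)
      rearrange : ∀ q d c o → q + 2 * d + c * o + c ≡ q + c * (1 + o) + 2 * d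
      rearrange = solve-∀

  lookup-N : ∀ k z i → lookup (N G k z) i ≡ (k ≤ᵇ ∣ S G i ∩ zeros G z ∣)
  lookup-N k z i = lookup∘tabulate _ i

  -- Moving v from 1 to 0 changes the energy by 2d − c, from 0 to 1 by c − 2d, where d is the
  -- number of zero neighbours of v; with c = 2k − 1 the move that N^k asks for is always negative.
  update-lowers-energy : ∀ m z v b → (suc m ≤ᵇ ∣ S G v ∩ zeros G z ∣) ≡ not b →
    energy (suc (2 * m)) (z [ v ]≔ not b) < energy (suc (2 * m)) (z [ v ]≔ b)
  update-lowers-energy m z v true  k≰ᵇd =
    +-≡-cancel-< (energy-[]≔ _ z v) (s≤s (*-monoʳ-≤ 2 (≤-pred (≤ᵇ≡false⇒> {suc m} {∣ S G v ∩ zeros G z ∣} k≰ᵇd))))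
  update-lowers-energy m z v false k≤ᵇd =
    +-≡-cancel-< (sym (energy-[]≔ _ z v))
      (≤-trans (≤-reflexive (sym (*-suc 2 m))) (*-monoʳ-≤ 2 (≤ᵇ≡true⇒≤ {suc m} {∣ S G v ∩ zeros G z ∣} k≤ᵇd)))

  unstable-flip-lowers-energy : ∀ m z v → lookup (N G (suc m) z) v ≢ lookup z v →
    energy (suc (2 * m)) (flip G z v) < energy (suc (2 * m)) z
  unstable-flip-lowers-energy m z v unstable =
    subst (energy (suc (2 * m)) (flip G z v) <_) (cong (energy (suc (2 * m))) ([]≔-lookup z v))
      (update-lowers-energy m z v (lookup z v) (trans (sym (lookup-N (suc m) z v)) (¬-not unstable)))

  fixedPoint-or-unstable : ∀ k z → FixedPoint G k z ⊎ ∃ λ v → lookup (N G k z) v ≢ lookup z v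
  fixedPoint-or-unstable k z with all? (λ i → lookup (N G k z) i ≟ᵇ lookup z i)
  ... | yes stable   = inj₁ (Pointwise-≡⇒≡ (ext stable))
  ... | no ¬stable = inj₂ (¬∀⟶∃¬ L _ (λ i → lookup (N G k z) i ≟ᵇ lookup z i) ¬stable)

  trapSpace-has-fixedPoint : ∀ m {A : State L → Set} → IsTrapSpace G (suc m) A →
    ∀ {z} → A z → ∃ λ x → A x × FixedPoint G (suc m) x
  trapSpace-has-fixedPoint m {A} trap {z} z∈A = descend z z∈A (<-wellFounded _)
    where
      descend : ∀ z → A z → Acc _<_ (energy (suc (2 * m)) z) → ∃ λ x → A x × FixedPoint G (suc m) x
      descend z z∈A (acc lower) with fixedPoint-or-unstable (suc m) z
      ... | inj₁ fixed = z , z∈A , fixed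
      ... | inj₂ (v , unstable) =
        descend (flip G z v) (trap z _ z∈A (v , unstable , refl)) (lower (unstable-flip-lowers-energy m z v unstable))

  SameSet-sym : ∀ {A B : State L → Set} → SameSet G A B → SameSet G B A
  SameSet-sym A≈B y = swap (A≈B y)

  trapSpace-resp-SameSet : ∀ {k} {A B : State L → Set} → SameSet G A B → IsTrapSpace G k A → IsTrapSpace G k B
  trapSpace-resp-SameSet A≈B trap y z y∈B edge = proj₁ (A≈B z) (trap y z (proj₂ (A≈B y) y∈B) edge)

  []ˢ-recentre : ∀ {x y J} → (_[_]ˢ G y J) x → SameSet G (_[_]ˢ G y J) (_[_]ˢ G x J)
  []ˢ-recentre x∈y[J] w = (λ w∈y[J] i i∉J → trans (w∈y[J] i i∉J) (sym (x∈y[J] i i∉J)))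
                        , (λ w∈x[J] i i∉J → trans (w∈x[J] i i∉J) (x∈y[J] i i∉J))

  trapSpace⇒stable : ∀ {k x J} → IsTrapSpace G k (_[_]ˢ G x J) →
    ∀ {w} → (_[_]ˢ G x J) w → ∀ {i} → i ∉ J → lookup (N G k w) i ≡ lookup w i
  trapSpace⇒stable {k} trap {w} w∈x[J] {i} i∉J with lookup (N G k w) i ≟ᵇ lookup w i
  ... | yes stable   = stable
  ... | no  unstable = ⊥-elim (not-¬ refl flipped-back)
    where
      flipped-back : lookup w i ≡ not (lookup w i)
      flipped-back = sym (trans (sym (lookup∘update i w _))
                       (trans (trap w (flip G w i) w∈x[J] (i , unstable , refl) i i∉J) (sym (w∈x[J] i i∉J))))

  BoundaryCondition : ℕ → State L → Subset L → Set
  BoundaryCondition k x I = ∀ i → _∈S[_] G i I → i ∉ I →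
    (lookup x i ≡ true → k ≤ ∣ S G i ∩ ∁ I ∩ zeros G x ∣) ×
    (lookup x i ≡ false → ∣ (S G i ∩ ∁ I ∩ zeros G x) ∪ (S G i ∩ I) ∣ < k)

  trapSpace⇒threshold : ∀ {k x J} → IsTrapSpace G k (_[_]ˢ G x J) →
    ∀ Z → (∀ j → j ∉ J → lookup Z j ≡ not (lookup x j)) →
    ∀ {i} → i ∉ J → (k ≤ᵇ ∣ S G i ∩ Z ∣) ≡ lookup x i
  trapSpace⇒threshold {k} {x} {J} trap Z Z≡zeros-x {i} i∉J = begin
    k ≤ᵇ ∣ S G i ∩ Z ∣          ≡⟨ cong (λ Z′ → k ≤ᵇ ∣ S G i ∩ Z′ ∣) (∁-involutive Z) ⟨
    k ≤ᵇ ∣ S G i ∩ ∁ (∁ Z) ∣    ≡⟨ lookup-N k (∁ Z) i ⟨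
    lookup (N G k (∁ Z)) i      ≡⟨ trapSpace⇒stable {k} {x} {J} trap ∁Z∈x[J] i∉J ⟩
    lookup (∁ Z) i              ≡⟨ ∁Z∈x[J] i i∉J ⟩
    lookup x i                  ∎
    where
      open ≡-Reasoning
      ∁Z∈x[J] : (_[_]ˢ G x J) (∁ Z)
      ∁Z∈x[J] j j∉J = trans (lookup-map j not Z) (trans (cong not (Z≡zeros-x j j∉J)) (not-involutive _))

  trapSpace⇒boundaryCondition : ∀ {k x J} → IsTrapSpace G k (_[_]ˢ G x J) → BoundaryCondition k x J
  trapSpace⇒boundaryCondition {k} {x} {J} trap i _ i∉J =
      (λ x[i]≡true → ≤ᵇ≡true⇒≤ (trans (trapSpace⇒threshold {k} {x} {J} trap Z₁ Z₁-off-J i∉J) x[i]≡true))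
    , (λ x[i]≡false → subst (_< k) (cong ∣_∣ (∩-distribˡ-∪ (S G i) Z₁ J))
                        (≤ᵇ≡false⇒> (trans (trapSpace⇒threshold {k} {x} {J} trap Z₀ Z₀-off-J i∉J) x[i]≡false)))
    where
      -- the zero sets of x with all of J set to 1, resp. to 0
      Z₁ Z₀ : Subset L
      Z₁ = ∁ J ∩ zeros G x
      Z₀ = Z₁ ∪ J
      J[j]≡false : ∀ {j} → j ∉ J → lookup J j ≡ false
      J[j]≡false = ∉⇒lookup≡false J
      Z₁-off-J : ∀ j → j ∉ J → lookup Z₁ j ≡ not (lookup x j)
      Z₁-off-J j j∉J = trans (lookup-zipWith _∧_ j (∁ J) (zeros G x))
        (cong₂ _∧_ (trans (lookup-map j not J) (cong not (J[j]≡false j∉J))) (lookup-map j not x))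
      Z₀-off-J : ∀ j → j ∉ J → lookup Z₀ j ≡ not (lookup x j)
      Z₀-off-J j j∉J = trans (lookup-zipWith _∨_ j Z₁ J)
        (trans (cong₂ _∨_ (Z₁-off-J j j∉J) (J[j]≡false j∉J)) (∨-identityʳ _))

  zeros-lower-bound : ∀ {x I w} → (_[_]ˢ G x I) w → ∁ I ∩ zeros G x ⊆ zeros G w
  zeros-lower-bound {x} {I} {w} w∈x[I] {j} j∈ with x∈p∩q⁻ (∁ I) (zeros G x) j∈
  ... | j∈∁I , j∈zeros-x =
    lookup≡false⇒∈∁ w (trans (w∈x[I] j (x∈∁p⇒x∉p j∈∁I)) (∈∁⇒lookup≡false x j∈zeros-x))

  zeros-upper-bound : ∀ {x I w} → (_[_]ˢ G x I) w → zeros G w ⊆ (∁ I ∩ zeros G x) ∪ I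
  zeros-upper-bound {x} {I} {w} w∈x[I] {j} j∈zeros-w with j ∈? I
  ... | yes j∈I = x∈p∪q⁺ (inj₂ j∈I)
  ... | no  j∉I = x∈p∪q⁺ (inj₁ (x∈p∩q⁺ (x∉p⇒x∈∁p j∉I ,
                    lookup≡false⇒∈∁ x (trans (sym (w∈x[I] j j∉I)) (∈∁⇒lookup≡false w j∈zeros-w)))))

  N-local : ∀ k {w x i} → (∀ {j} → j ∈ S G i → lookup w j ≡ lookup x j) → lookup (N G k w) i ≡ lookup (N G k x) i
  N-local k {w} {x} {i} agree = begin
    lookup (N G k w) i            ≡⟨ lookup-N k w i ⟩
    k ≤ᵇ ∣ S G i ∩ zeros G w ∣    ≡⟨ cong (λ Z → k ≤ᵇ ∣ Z ∣) (∩∁-cong (S G i) agree) ⟩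
    k ≤ᵇ ∣ S G i ∩ zeros G x ∣    ≡⟨ lookup-N k x i ⟨
    lookup (N G k x) i            ∎
    where open ≡-Reasoning

  boundaryCondition⇒stable : ∀ {k x I} → FixedPoint G k x → BoundaryCondition k x I →
    ∀ {w} → (_[_]ˢ G x I) w → ∀ {i} → i ∉ I → lookup (N G k w) i ≡ lookup x i
  boundaryCondition⇒stable {k} {x} {I} fixed bc {w} w∈x[I] {i} i∉I
    with any? (λ j → (j ∈? I) ×-dec (i ∈? S G j))
  ... | yes i∈S[I] = trans (lookup-N k w i)
          (≤ᵇ-between (lookup x i) lower upper (proj₁ (bc i i∈S[I] i∉I)) (proj₂ (bc i i∈S[I] i∉I)))
    where
      lower : ∣ S G i ∩ ∁ I ∩ zeros G x ∣ ≤ ∣ S G i ∩ zeros G w ∣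
      lower = p⊆q⇒∣p∣≤∣q∣ (∩-monoʳ-⊆ (S G i) (zeros-lower-bound w∈x[I]))
      upper : ∣ S G i ∩ zeros G w ∣ ≤ ∣ (S G i ∩ ∁ I ∩ zeros G x) ∪ (S G i ∩ I) ∣
      upper = subst (∣ S G i ∩ zeros G w ∣ ≤_) (cong ∣_∣ (∩-distribˡ-∪ (S G i) (∁ I ∩ zeros G x) I))
                (p⊆q⇒∣p∣≤∣q∣ (∩-monoʳ-⊆ (S G i) (zeros-upper-bound w∈x[I])))
  ... | no i∉S[I] = trans (N-local k agree) (cong (λ z → lookup z i) fixed)
    where
      agree : ∀ {j} → j ∈ S G i → lookup w j ≡ lookup x j
      agree {j} j∈Si = w∈x[I] j (λ j∈I → i∉S[I] (j , j∈I , S-sym j∈Si))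

  boundaryCondition⇒trapSpace : ∀ {k x I} → FixedPoint G k x → BoundaryCondition k x I →
    IsTrapSpace G k (_[_]ˢ G x I)
  boundaryCondition⇒trapSpace fixed bc w _ w∈x[I] (v , unstable , refl) i i∉I with i ≟ᶠ v
  ... | yes refl =
    ⊥-elim (unstable (trans (boundaryCondition⇒stable fixed bc w∈x[I] i∉I) (sym (w∈x[I] i i∉I))))
  ... | no  i≢v  = trans (lookup∘update′ i≢v w _) (w∈x[I] i i∉I)

  trapSpace⇒fixedPoint-with-boundaryCondition : ∀ m y J → IsTrapSpace G (suc m) (_[_]ˢ G y J) →
    ∃₂ λ x I → SameSet G (_[_]ˢ G y J) (_[_]ˢ G x I) × FixedPoint G (suc m) x × BoundaryCondition (suc m) x I
  trapSpace⇒fixedPoint-with-boundaryCondition m y J trap with trapSpace-has-fixedPoint m trap {y} (λ _ _ → refl)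
  ... | x , x∈y[J] , fixed = x , J , y[J]≈x[J] , fixed ,
        trapSpace⇒boundaryCondition {x = x} {J} (trapSpace-resp-SameSet {suc m} {_[_]ˢ G y J} y[J]≈x[J] trap)
    where
      y[J]≈x[J] : SameSet G (_[_]ˢ G y J) (_[_]ˢ G x J)
      y[J]≈x[J] = []ˢ-recentre {x} {y} {J} x∈y[J]

  fixedPoint-with-boundaryCondition⇒trapSpace : ∀ k y J →
    (∃₂ λ x I → SameSet G (_[_]ˢ G y J) (_[_]ˢ G x I) × FixedPoint G k x × BoundaryCondition k x I) →
    IsTrapSpace G k (_[_]ˢ G y J)
  fixedPoint-with-boundaryCondition⇒trapSpace k y J (x , I , y[J]≈x[I] , fixed , bc) =
    trapSpace-resp-SameSet {k} {_[_]ˢ G x I} (SameSet-sym y[J]≈x[I]) (boundaryCondition⇒trapSpace fixed bc)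

proposition11 : ∀ {L : ℕ} (G : Graph L) → Connected G → (k : ℕ) → 1 ≤ k →
    ∀ (y : State L) (J : Subset L) →
      IsTrapSpace G k (_[_]ˢ G y J) ⇔
      (∃₂ λ (x : State L) (I : Subset L) →
        SameSet G (_[_]ˢ G y J) (_[_]ˢ G x I) × FixedPoint G k x ×
        (∀ (i : Fin L) → _∈S[_] G i I → i ∉ I →
          (lookup x i ≡ true → k ≤ ∣ S G i ∩ ∁ I ∩ zeros G x ∣) ×
          (lookup x i ≡ false → ∣ (S G i ∩ ∁ I ∩ zeros G x) ∪ (S G i ∩ I) ∣ < k)))
proposition11 G _ (suc m) _ y J =
  mk⇔ (trapSpace⇒fixedPoint-with-boundaryCondition G m y J)
      (fixedPoint-with-boundaryCondition⇒trapSpace G (suc m) y J)
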